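{- Let $q$ be a prime power and $L(X)=a_1X^q+a_0X\in\mathbb{F}_{q^2}[X]$. Then $f(X)=\mathrm{Tr}_{q^2/q}(L(X)/X)$ has no root in $\mathbb{F}_{q^2}^*$ if and only if the polynomial $g(X)=X^2+\mathrm{Tr}_{q^2/q}(a_0)X+a_1^{q+1}\in\mathbb{F}_q[X]$ has two distinct roots in $\mathbb{F}_q$.
   Context: $\mathrm{Tr}_{q^2/q}$ denotes the trace map from $\mathbb{F}_{q^2}$ to $\mathbb{F}_q$. -}

module Defs where

open import Level using (Level)
open import Data.Nat using (ℕ; zero; suc; _∸_; _^_)
open import Data.Nat.Primality using (Prime)
open import Data.Fin using (Fin)
open import Data.Product using (Σ; ∃; ∃-syntax; _×_)
open import Relation.Nullary using (¬_)
open import Relation.Binary.PropositionalEquality using (_≡_)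
import Relation.Binary.PropositionalEquality as P
open import Function.Bundles using (Bijection)
open import Algebra.Bundles using (CommutativeRing)

IsPrimePower : ℕ → Set
IsPrimePower q = Σ ℕ λ p → Σ ℕ λ k → Prime p × q ≡ p ^ suc k

module _ {c ℓ : Level} (F : CommutativeRing c ℓ) where
  open CommutativeRing F

  pow : Carrier → ℕ → Carrier
  pow x zero    = 1#
  pow x (suc n) = x * pow x n

  IsField : Set (c Level.⊔ ℓ)
  IsField = (¬ 0# ≈ 1#) × (∀ x → ¬ x ≈ 0# → ∃[ y ] x * y ≈ 1#)

  HasCard : ℕ → Set (c Level.⊔ ℓ)
  HasCard n = Bijection (P.setoid (Fin n)) setoid

  module _ (q : ℕ) where
    InSubfield : Carrier → Set ℓ
    InSubfield x = pow x q ≈ x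

    Tr : Carrier → Carrier
    Tr x = x + pow x q

    -- f(X) = Tr(L(X)/X) with L(X) = a1 X^q + a0 X, i.e. L(X)/X = a1 X^(q-1) + a0
    fTr : (a0 a1 : Carrier) → Carrier → Carrier
    fTr a0 a1 x = Tr (a1 * pow x (q ∸ 1) + a0)

    gPoly : (a0 a1 : Carrier) → Carrier → Carrier
    gPoly a0 a1 y = y * y + Tr a0 * y + pow a1 (suc q)

module Submission where

-- Theorem 3.2.  F = F_{q²}, Fr x = x^q, W x = a1 x^(q-1), T = Tr a0, N = a1^(q+1).
-- Then f x = Tr (W x) + T, and for x ≠ 0 the value w = W x has norm w · Fr w = N,
-- so a root x ≠ 0 of f gives a root w of g with Tr w = -T.
-- (⇐) If g has distinct roots y, z ∈ F_q, such a w is y or z, hence lies in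
--     F_q, and then 2w = -T = y + z forces y = z.
-- (⇒) If a1 = 0, f is the constant T ≠ 0 and g has the roots 0 and -T.  Else
--     count: W has ≥ q + 1 values on F*, F_q* has ≥ q - 1 elements, the trace
--     and x ↦ x + N/x map them into F_q (≤ q elements), over each t the two
--     fibres hold ≤ 2 roots of y² - t y + N, and no W-value lies over -T.
--     Hence 2q ≤ 2(q - 1) + #(fibre over -T): g has two roots in F_q*.

open import Level using (Level)
open import Algebra.Bundles using (CommutativeRing)
open import Data.Nat as ℕ using (ℕ; zero; suc; _≤_; _<_; z≤n; s≤s)
open import Data.Nat.Primality using (Prime)
import Data.Nat.Properties as ℕP
open import Data.Product using (∃; ∃-syntax; _×_; _,_; proj₁; proj₂)
open import Data.Empty using (⊥; ⊥-elim)
open import Relation.Nullary using (¬_; Dec; yes; no)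
open import Relation.Binary.PropositionalEquality as P using (_≡_)
open import Function.Bundles using (_⇔_; mk⇔)
open import Defs

-- The ring solver of the standard library, instantiated for an arbitrary
-- commutative ring with integer coefficients through the canonical
-- morphism ℤ → R.
module IntegerRingSolver {c ℓ : Level} (R : CommutativeRing c ℓ) where
  open CommutativeRing R
  open import Data.Integer as ℤ using (ℤ; +_; -[1+_]; _⊖_; sign; ∣_∣; _◃_)
  import Data.Integer.Properties as ℤP
  open import Data.Sign as Sign using (Sign)
  open import Data.Maybe using (Maybe; just; nothing)
  open import Algebra.Properties.Ring ring using (-‿distribˡ-*; -‿distribʳ-*)
  open import Algebra.Properties.AbelianGroup +-abelianGroup using (⁻¹-∙-comm)
  open import Algebra.Properties.Group +-group using (⁻¹-involutive; ε⁻¹≈ε)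
  open import Algebra.Properties.Semiring.Mult semiring using (×-homo-+; ×1-homo-*) renaming (_×_ to _×ₙ_)
  open import Algebra.Solver.Ring.AlmostCommutativeRing
  open import Relation.Binary.Reasoning.Setoid setoid

  ⟦_⟧ℤ : ℤ → Carrier
  ⟦ + n ⟧ℤ      = n ×ₙ 1#
  ⟦ -[1+ n ] ⟧ℤ = - (suc n ×ₙ 1#)

  signed : Sign → Carrier → Carrier
  signed Sign.+ x = x
  signed Sign.- x = - x

  signed-cong : ∀ s {x y} → x ≈ y → signed s x ≈ signed s y
  signed-cong Sign.+ x≈y = x≈y
  signed-cong Sign.- x≈y = -‿cong x≈y

  signed-* : ∀ s t a b → signed (s Sign.* t) (a * b) ≈ signed s a * signed t b
  signed-* Sign.+ Sign.+ a b = refl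
  signed-* Sign.+ Sign.- a b = -‿distribʳ-* a b
  signed-* Sign.- Sign.+ a b = -‿distribˡ-* a b
  signed-* Sign.- Sign.- a b = sym (begin
    - a * - b   ≈⟨ sym (-‿distribˡ-* a (- b)) ⟩
    - (a * - b) ≈⟨ -‿cong (sym (-‿distribʳ-* a b)) ⟩
    - - (a * b) ≈⟨ ⁻¹-involutive _ ⟩
    a * b       ∎)

  ⟦⟧-sign-abs : ∀ i → ⟦ i ⟧ℤ ≈ signed (sign i) (∣ i ∣ ×ₙ 1#)
  ⟦⟧-sign-abs (+ n)    = refl
  ⟦⟧-sign-abs -[1+ n ] = refl

  ⟦⟧-◃ : ∀ s n → ⟦ s ◃ n ⟧ℤ ≈ signed s (n ×ₙ 1#)
  ⟦⟧-◃ Sign.+ zero    = refl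
  ⟦⟧-◃ Sign.- zero    = sym ε⁻¹≈ε
  ⟦⟧-◃ Sign.+ (suc n) = refl
  ⟦⟧-◃ Sign.- (suc n) = refl

  ⟦⟧-⊖ : ∀ m n → ⟦ m ⊖ n ⟧ℤ ≈ m ×ₙ 1# - n ×ₙ 1#
  ⟦⟧-⊖ zero    zero    = sym (-‿inverseʳ 0#)
  ⟦⟧-⊖ zero    (suc n) = sym (+-identityˡ _)
  ⟦⟧-⊖ (suc m) zero    = sym (trans (+-congˡ ε⁻¹≈ε) (+-identityʳ _))
  ⟦⟧-⊖ (suc m) (suc n) = begin
    ⟦ suc m ⊖ suc n ⟧ℤ      ≡⟨ P.cong ⟦_⟧ℤ (ℤP.[1+m]⊖[1+n]≡m⊖n m n) ⟩
    ⟦ m ⊖ n ⟧ℤ              ≈⟨ ⟦⟧-⊖ m n ⟩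
    m ×ₙ 1# - n ×ₙ 1#         ≈⟨ sym (cancel-front 1# _ _) ⟩
    suc m ×ₙ 1# - suc n ×ₙ 1# ∎
    where
    cancel-front : ∀ c a b → (c + a) - (c + b) ≈ a - b
    cancel-front c a b = begin
      (c + a) + - (c + b)   ≈⟨ +-congˡ (sym (⁻¹-∙-comm c b)) ⟩
      (c + a) + (- c + - b) ≈⟨ +-assoc c a _ ⟩
      c + (a + (- c + - b)) ≈⟨ +-congˡ (sym (+-assoc a (- c) (- b))) ⟩
      c + ((a + - c) + - b) ≈⟨ +-congˡ (+-congʳ (+-comm a (- c))) ⟩
      c + ((- c + a) + - b) ≈⟨ +-congˡ (+-assoc (- c) a (- b)) ⟩
      c + (- c + (a + - b)) ≈⟨ sym (+-assoc c (- c) _) ⟩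
      (c + - c) + (a + - b) ≈⟨ +-congʳ (-‿inverseʳ c) ⟩
      0# + (a - b)          ≈⟨ +-identityˡ _ ⟩
      a - b                 ∎

  ⟦⟧-+ : ∀ i j → ⟦ i ℤ.+ j ⟧ℤ ≈ ⟦ i ⟧ℤ + ⟦ j ⟧ℤ
  ⟦⟧-+ (+ m)    (+ n)    = ×-homo-+ 1# m n
  ⟦⟧-+ (+ m)    -[1+ n ] = ⟦⟧-⊖ m (suc n)
  ⟦⟧-+ -[1+ m ] (+ n)    = trans (⟦⟧-⊖ n (suc m)) (+-comm _ _)
  ⟦⟧-+ -[1+ m ] -[1+ n ] = begin
    - (suc (suc (m ℕ.+ n)) ×ₙ 1#)    ≡⟨ P.cong (λ k → - (k ×ₙ 1#)) (P.sym (ℕP.+-suc (suc m) n)) ⟩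
    - ((suc m ℕ.+ suc n) ×ₙ 1#)      ≈⟨ -‿cong (×-homo-+ 1# (suc m) (suc n)) ⟩
    - (suc m ×ₙ 1# + suc n ×ₙ 1#)     ≈⟨ sym (⁻¹-∙-comm _ _) ⟩
    - (suc m ×ₙ 1#) + - (suc n ×ₙ 1#) ∎

  ⟦⟧-* : ∀ i j → ⟦ i ℤ.* j ⟧ℤ ≈ ⟦ i ⟧ℤ * ⟦ j ⟧ℤ
  ⟦⟧-* i j = begin
    ⟦ (sign i Sign.* sign j) ◃ (∣ i ∣ ℕ.* ∣ j ∣) ⟧ℤ          ≈⟨ ⟦⟧-◃ (sign i Sign.* sign j) (∣ i ∣ ℕ.* ∣ j ∣) ⟩
    signed (sign i Sign.* sign j) ((∣ i ∣ ℕ.* ∣ j ∣) ×ₙ 1#)   ≈⟨ signed-cong (sign i Sign.* sign j) (×1-homo-* ∣ i ∣ ∣ j ∣) ⟩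
    signed (sign i Sign.* sign j) ((∣ i ∣ ×ₙ 1#) * (∣ j ∣ ×ₙ 1#)) ≈⟨ signed-* (sign i) (sign j) _ _ ⟩
    signed (sign i) (∣ i ∣ ×ₙ 1#) * signed (sign j) (∣ j ∣ ×ₙ 1#) ≈⟨ sym (*-cong (⟦⟧-sign-abs i) (⟦⟧-sign-abs j)) ⟩
    ⟦ i ⟧ℤ * ⟦ j ⟧ℤ                                         ∎

  ⟦⟧-neg : ∀ i → ⟦ ℤ.- i ⟧ℤ ≈ - ⟦ i ⟧ℤ
  ⟦⟧-neg -[1+ n ]    = sym (⁻¹-involutive _)
  ⟦⟧-neg (+ zero)    = sym ε⁻¹≈ε
  ⟦⟧-neg (+ (suc n)) = refl

  morphism : ℤ.+-*-rawRing -Raw-AlmostCommutative⟶ fromCommutativeRing R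
  morphism = record
    { ⟦_⟧ = ⟦_⟧ℤ ; +-homo = ⟦⟧-+ ; *-homo = ⟦⟧-* ; -‿homo = ⟦⟧-neg
    ; 0-homo = refl ; 1-homo = +-identityʳ 1# }

  equal-coefficients? : ∀ i j → Maybe (⟦ i ⟧ℤ ≈ ⟦ j ⟧ℤ)
  equal-coefficients? i j with i ℤ.≟ j
  ... | yes P.refl = just refl
  ... | no _       = nothing

  open import Algebra.Solver.Ring ℤ.+-*-rawRing (fromCommutativeRing R) morphism equal-coefficients? public

module PowerLaws {c ℓ : Level} (R : CommutativeRing c ℓ) where
  open CommutativeRing R
  open import Algebra.Properties.Semiring.Exp semiring using (_^_; ^-congˡ; ^-homo-*; ^-assocʳ)
  open import Algebra.Properties.CommutativeSemiring.Exp commutativeSemiring using (^-distrib-*)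

  pow≡^ : ∀ x n → pow R x n ≡ x ^ n
  pow≡^ x zero    = P.refl
  pow≡^ x (suc n) = P.cong (x *_) (pow≡^ x n)

  pow-cong : ∀ {x y} n → x ≈ y → pow R x n ≈ pow R y n
  pow-cong {x} {y} n x≈y rewrite pow≡^ x n | pow≡^ y n = ^-congˡ n x≈y

  pow-+ : ∀ x m n → pow R x (m ℕ.+ n) ≈ pow R x m * pow R x n
  pow-+ x m n rewrite pow≡^ x (m ℕ.+ n) | pow≡^ x m | pow≡^ x n = ^-homo-* x m n

  pow-* : ∀ x m n → pow R x (m ℕ.* n) ≈ pow R (pow R x m) n
  pow-* x m n rewrite pow≡^ (pow R x m) n | pow≡^ x (m ℕ.* n) | pow≡^ x m = sym (^-assocʳ x m n)

  pow-distrib-* : ∀ x y n → pow R (x * y) n ≈ pow R x n * pow R y n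
  pow-distrib-* x y n rewrite pow≡^ (x * y) n | pow≡^ x n | pow≡^ y n = ^-distrib-* x y n

  pow-swap : ∀ x m n → pow R (pow R x m) n ≈ pow R (pow R x n) m
  pow-swap x m n = trans (sym (pow-* x m n)) (trans (reflexive (P.cong (pow R x) (ℕP.*-comm m n))) (pow-* x n m))

  pow-zero : ∀ n → pow R 0# (suc n) ≈ 0#
  pow-zero n = zeroˡ _

module FieldLemmas {c ℓ : Level} (F : CommutativeRing c ℓ) (isField : IsField F) where
  open CommutativeRing F
  open PowerLaws F
  open IntegerRingSolver F using (solve; _:*_; _:-_; _:=_)
  open import Algebra.Properties.Group +-group using (x∙y⁻¹≈ε⇒x≈y; x≈y⇒x∙y⁻¹≈ε)
  open import Relation.Binary.Reasoning.Setoid setoid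

  0≉1 : ¬ 0# ≈ 1#
  0≉1 = proj₁ isField

  inverse : ∀ x → ¬ x ≈ 0# → ∃[ y ] x * y ≈ 1#
  inverse = proj₂ isField

  no-zero-divisors : ∀ {a b} → ¬ a ≈ 0# → a * b ≈ 0# → b ≈ 0#
  no-zero-divisors {a} {b} a≉0 ab≈0 with inverse a a≉0
  ... | (a⁻¹ , aa⁻¹≈1) = begin
    b             ≈⟨ sym (*-identityˡ b) ⟩
    1# * b        ≈⟨ *-congʳ (trans (sym aa⁻¹≈1) (*-comm a a⁻¹)) ⟩
    (a⁻¹ * a) * b ≈⟨ *-assoc a⁻¹ a b ⟩
    a⁻¹ * (a * b) ≈⟨ *-congˡ ab≈0 ⟩
    a⁻¹ * 0#      ≈⟨ zeroʳ a⁻¹ ⟩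
    0#            ∎

  *-nonzero : ∀ {a b} → ¬ a ≈ 0# → ¬ b ≈ 0# → ¬ a * b ≈ 0#
  *-nonzero a≉0 b≉0 ab≈0 = b≉0 (no-zero-divisors a≉0 ab≈0)

  pow-nonzero : ∀ {x} n → ¬ x ≈ 0# → ¬ pow F x n ≈ 0#
  pow-nonzero zero    x≉0 1≈0 = 0≉1 (sym 1≈0)
  pow-nonzero (suc n) x≉0     = *-nonzero x≉0 (pow-nonzero n x≉0)

  *-cancelˡ : ∀ {a b c} → ¬ a ≈ 0# → a * b ≈ a * c → b ≈ c
  *-cancelˡ {a} {b} {c} a≉0 ab≈ac = x∙y⁻¹≈ε⇒x≈y b c (no-zero-divisors a≉0 (begin
    a * (b - c)   ≈⟨ solve 3 (λ a b c → a :* (b :- c) := a :* b :- a :* c) refl a b c ⟩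
    a * b - a * c ≈⟨ x≈y⇒x∙y⁻¹≈ε ab≈ac ⟩
    0#            ∎))

module PrimeBinomial where
  open import Data.Sum using (inj₁; inj₂)
  open import Data.Nat using (_*_; _∸_; _!; nonTrivial⇒n>1)
  open import Data.Nat.Properties using (_!*_!≢0)
  open import Data.Nat.Divisibility using (_∣_; ∣⇒≤; ∣1⇒≡1; m∣m*n)
  open import Data.Nat.Primality using (euclidsLemma; prime⇒nonTrivial)
  open import Data.Nat.Combinatorics using (_C_; k![n∸k]!∣n!)
  open import Data.Nat.Combinatorics.Specification using (nCk≡n!/k![n-k]!)
  open import Data.Nat.DivMod using (m/n*n≡m)

  prime≥2 : ∀ {p} → Prime p → 2 ≤ p
  prime≥2 {p} p-prime = nonTrivial⇒n>1 p {{prime⇒nonTrivial p-prime}}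

  prime∣!⇒≤ : ∀ {p} → Prime p → ∀ m → p ∣ m ! → p ≤ m
  prime∣!⇒≤ p-prime zero    p∣1 = ⊥-elim (ℕP.<⇒≢ (prime≥2 p-prime) (P.sym (∣1⇒≡1 p∣1)))
  prime∣!⇒≤ p-prime (suc m) p∣m! with euclidsLemma (suc m) (m !) p-prime p∣m!
  ... | inj₁ p∣1+m = ∣⇒≤ p∣1+m
  ... | inj₂ p∣m!  = ℕP.m≤n⇒m≤1+n (prime∣!⇒≤ p-prime m p∣m!)

  -- p divides p! = (p C k) · (k! (p - k)!)
  divides-binomial-product : ∀ {p k} → 0 < p → k ≤ p → p ∣ (p C k) * (k ! * (p ∸ k) !)
  divides-binomial-product {suc p′} {k} _ k≤p = P.subst (suc p′ ∣_) (P.sym p!≡) (m∣m*n (p′ !))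
    where
    instance _ = k !* (suc p′ ∸ k) !≢0
    p!≡ : (suc p′ C k) * (k ! * (suc p′ ∸ k) !) ≡ suc p′ !
    p!≡ = P.trans (P.cong (_* (k ! * (suc p′ ∸ k) !)) (nCk≡n!/k![n-k]! k≤p)) (m/n*n≡m (k![n∸k]!∣n! k≤p))

  -- but p divides neither k! nor (p - k)!, as both k and p - k are below p
  prime∣binomial : ∀ {p k} → Prime p → 0 < k → k < p → p ∣ p C k
  prime∣binomial {p} {k} p-prime 0<k k<p
    with euclidsLemma (p C k) (k ! * (p ∸ k) !) p-prime (divides-binomial-product (ℕP.<-trans 0<k k<p) (ℕP.<⇒≤ k<p))
  ... | inj₁ p∣pCk = p∣pCk
  ... | inj₂ p∣rest with euclidsLemma (k !) ((p ∸ k) !) p-prime p∣rest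
  ... | inj₁ p∣k!     = ⊥-elim (ℕP.<⇒≱ k<p (prime∣!⇒≤ p-prime k p∣k!))
  ... | inj₂ p∣[p∸k]! = ⊥-elim (ℕP.<⇒≱ (ℕP.∸-monoʳ-< 0<k (ℕP.<⇒≤ k<p)) (prime∣!⇒≤ p-prime (p ∸ k) p∣[p∸k]!))

-- In a commutative ring in which the prime p = suc p′ is zero, the maps
-- x ↦ x^p and x ↦ x^(p^k) are additive: the inner binomial terms vanish.
module Frobenius {c ℓ : Level} (R : CommutativeRing c ℓ) (p′ : ℕ) where
  open CommutativeRing R
  open PowerLaws R
  open PrimeBinomial using (prime∣binomial)
  open import Data.Nat using (_∸_)
  open import Data.Nat.Divisibility using (divides)
  open import Data.Nat.Combinatorics using (_C_; nCn≡1)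
  open import Data.Fin as Fin using (toℕ; inject₁; fromℕ)
  import Data.Fin.Properties as FinP
  open import Algebra.Properties.Semiring.Mult semiring using (×-assoc-*; ×-congʳ; ×1-homo-*) renaming (_×_ to _×ₙ_)
  open import Algebra.Properties.Semiring.Exp semiring using (_^_)
  open import Algebra.Properties.Semiring.Sum semiring using (sum; sum-init-last; sum-cong-≋; sum-replicate-zero)
  import Algebra.Properties.CommutativeSemiring.Binomial commutativeSemiring as Binomial
  open import Relation.Binary.Reasoning.Setoid setoid

  p : ℕ
  p = suc p′

  module _ (p-prime : Prime p) (char-p : p ×ₙ 1# ≈ 0#) where

    ×ₙ-as-product : ∀ n b → n ×ₙ b ≈ (n ×ₙ 1#) * b
    ×ₙ-as-product n b = trans (×-congʳ n (sym (*-identityˡ b))) (sym (×-assoc-* n 1# b))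

    inner-binomial-vanishes : ∀ k → 0 < k → k < p → ∀ b → (p C k) ×ₙ b ≈ 0#
    inner-binomial-vanishes k 0<k k<p b with prime∣binomial p-prime 0<k k<p
    ... | divides d pCk≡d*p = begin
      (p C k) ×ₙ b                  ≡⟨ P.cong (_×ₙ b) pCk≡d*p ⟩
      (d ℕ.* p) ×ₙ b                ≈⟨ ×ₙ-as-product (d ℕ.* p) b ⟩
      ((d ℕ.* p) ×ₙ 1#) * b         ≈⟨ *-congʳ (×1-homo-* d p) ⟩
      ((d ×ₙ 1#) * (p ×ₙ 1#)) * b   ≈⟨ *-congʳ (trans (*-congˡ char-p) (zeroʳ _)) ⟩
      0# * b                        ≈⟨ zeroˡ b ⟩
      0#                            ∎

    pow≈^ : ∀ x n → pow R x n ≈ x ^ n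
    pow≈^ x n = reflexive (pow≡^ x n)

    -- (x + y)^p = Σ_(k ≤ p) (p C k) x^k y^(p-k): the extreme terms are y^p and
    -- x^p, and all the others vanish
    frobenius : ∀ x y → pow R (x + y) p ≈ pow R x p + pow R y p
    frobenius x y = begin
      pow R (x + y) p            ≈⟨ pow≈^ (x + y) p ⟩
      (x + y) ^ p                ≈⟨ Binomial.theorem p x y ⟩
      sum term                   ≈⟨ +-congˡ (sum-init-last (λ i → term (Fin.suc i))) ⟩
      term Fin.zero + (sum (λ i → term (Fin.suc (inject₁ i))) + term (Fin.suc (fromℕ p′)))
                                 ≈⟨ +-cong first-term (+-cong inner-terms last-term) ⟩
      pow R y p + (0# + pow R x p) ≈⟨ trans (+-congˡ (+-identityˡ _)) (+-comm _ _) ⟩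
      pow R x p + pow R y p      ∎
      where
      term = Binomial.binomialTerm x y p
      first-term : term Fin.zero ≈ pow R y p
      first-term = trans (+-identityʳ _) (trans (*-identityˡ _) (sym (pow≈^ y p)))
      inner-terms : sum (λ i → term (Fin.suc (inject₁ i))) ≈ 0#
      inner-terms = trans (sum-cong-≋ vanishes) (sum-replicate-zero p′)
        where
        vanishes : ∀ i → term (Fin.suc (inject₁ i)) ≈ 0#
        vanishes i = inner-binomial-vanishes (suc (toℕ (inject₁ i))) (s≤s z≤n)
          (P.subst (λ j → suc j < p) (P.sym (FinP.toℕ-inject₁ i)) (s≤s (FinP.toℕ<n i))) _
      last-term : term (Fin.suc (fromℕ p′)) ≈ pow R x p
      last-term = begin
        term (Fin.suc (fromℕ p′))         ≡⟨ P.cong (λ j → (p C j) ×ₙ ((x ^ j) * (y ^ (p ∸ j)))) (P.cong suc (FinP.toℕ-fromℕ p′)) ⟩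
        (p C p) ×ₙ ((x ^ p) * (y ^ (p ∸ p))) ≡⟨ P.cong₂ (λ a b → a ×ₙ ((x ^ p) * (y ^ b))) (nCn≡1 p) (ℕP.n∸n≡0 p) ⟩
        1 ×ₙ ((x ^ p) * 1#)               ≈⟨ trans (+-identityʳ _) (trans (*-identityʳ _) (sym (pow≈^ x p))) ⟩
        pow R x p                         ∎

    frobenius-iterate : ∀ k x y → pow R (x + y) (p ℕ.^ k) ≈ pow R x (p ℕ.^ k) + pow R y (p ℕ.^ k)
    frobenius-iterate zero    x y = trans (*-identityʳ _) (sym (+-cong (*-identityʳ x) (*-identityʳ y)))
    frobenius-iterate (suc k) x y = begin
      pow R (x + y) (p ℕ.* p ℕ.^ k)                    ≈⟨ pow-* (x + y) p (p ℕ.^ k) ⟩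
      pow R (pow R (x + y) p) (p ℕ.^ k)                ≈⟨ pow-cong (p ℕ.^ k) (frobenius x y) ⟩
      pow R (pow R x p + pow R y p) (p ℕ.^ k)          ≈⟨ frobenius-iterate k (pow R x p) (pow R y p) ⟩
      pow R (pow R x p) (p ℕ.^ k) + pow R (pow R y p) (p ℕ.^ k)
                                                       ≈⟨ sym (+-cong (pow-* x p (p ℕ.^ k)) (pow-* y p (p ℕ.^ k))) ⟩
      pow R x (p ℕ.* p ℕ.^ k) + pow R y (p ℕ.* p ℕ.^ k) ∎

module FiniteField {c ℓ : Level} (F : CommutativeRing c ℓ) (isField : IsField F)
                   (m : ℕ) (card : HasCard F (suc m)) where
  open CommutativeRing F
  open PowerLaws F
  open FieldLemmas F isField
  open IntegerRingSolver F using (solve; _:+_; _:-_; :-_; _:=_)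
  open import Data.Fin as Fin using (Fin; punchIn)
  import Data.Fin.Properties as FinP
  open import Data.Fin.Permutation using (Permutation′; permutation; _⟨$⟩ʳ_)
  open import Function.Bundles using (Bijection; Surjection)
  open import Algebra.Definitions _≈_ using (Congruent₁)
  open import Algebra.Properties.Group +-group using (∙-cancelʳ)
  open import Algebra.Properties.Semiring.Mult semiring using () renaming (_×_ to _×ₙ_)
  import Algebra.Properties.CommutativeMonoid.Sum as MonoidSum
  module Sum = MonoidSum +-commutativeMonoid
  module Product = MonoidSum *-commutativeMonoid
  open import Relation.Binary.Reasoning.Setoid setoid

  e : Fin (suc m) → Carrier
  e = Bijection.to card

  e-injective : ∀ {i j} → e i ≈ e j → i ≡ j
  e-injective = Bijection.injective card

  index : Carrier → Fin (suc m)
  index = Bijection.to⁻ card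

  e-index : ∀ x → e (index x) ≈ x
  e-index = Surjection.to∘to⁻ (Bijection.surjection card)

  index-cong : ∀ {x y} → x ≈ y → index x ≡ index y
  index-cong {x} {y} x≈y = e-injective (trans (e-index x) (trans x≈y (sym (e-index y))))

  index-e : ∀ i → index (e i) ≡ i
  index-e i = e-injective (e-index (e i))

  _≈?_ : ∀ x y → Dec (x ≈ y)
  x ≈? y with index x Fin.≟ index y
  ... | yes ix≡iy = yes (trans (sym (e-index x)) (trans (reflexive (P.cong e ix≡iy)) (e-index y)))
  ... | no  ix≢iy = no (λ x≈y → ix≢iy (index-cong x≈y))

  nilpotent⇒zero : ∀ {x} n → pow F x n ≈ 0# → x ≈ 0#
  nilpotent⇒zero {x} n xⁿ≈0 with x ≈? 0#
  ... | yes x≈0 = x≈0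
  ... | no  x≉0 = ⊥-elim (pow-nonzero n x≉0 xⁿ≈0)

  reindex : (f g : Carrier → Carrier) → Congruent₁ f → Congruent₁ g →
            (∀ x → f (g x) ≈ x) → (∀ x → g (f x) ≈ x) → Permutation′ (suc m)
  reindex f g f-cong g-cong fg≈id gf≈id = permutation (λ i → index (f (e i))) (λ i → index (g (e i)))
    (λ i → P.trans (index-cong (trans (f-cong (e-index _)) (fg≈id (e i)))) (index-e i))
    (λ i → P.trans (index-cong (trans (g-cong (e-index _)) (gf≈id (e i)))) (index-e i))

  -- adding up all elements of F: Σ x = Σ (1 + x), hence (suc m) · 1 = 0
  characteristic : suc m ×ₙ 1# ≈ 0#
  characteristic = ∙-cancelʳ S (suc m ×ₙ 1#) 0# (begin
    (suc m ×ₙ 1#) + S                    ≈⟨ +-congʳ (sym (Sum.sum-replicate (suc m))) ⟩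
    Sum.sum {suc m} (λ _ → 1#) + S       ≈⟨ sym (Sum.∑-distrib-+ {suc m} (λ _ → 1#) e) ⟩
    Sum.sum {suc m} (λ i → 1# + e i)     ≈⟨ Sum.sum-cong-≋ (λ i → sym (e-index (1# + e i))) ⟩
    Sum.sum {suc m} (λ i → e (π ⟨$⟩ʳ i)) ≈⟨ sym (Sum.∑-permute e π) ⟩
    S                                    ≈⟨ sym (+-identityˡ S) ⟩
    0# + S                               ∎)
    where
    S = Sum.sum e
    π = reindex (1# +_) (- 1# +_) +-congˡ +-congˡ
          (solve 2 (λ a x → a :+ (:- a :+ x) := x) refl 1#)
          (solve 2 (λ a x → :- a :+ (a :+ x) := x) refl 1#)

  patch : Carrier → Carrier → Carrier
  patch c x with x ≈? 0#
  ... | yes _ = c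
  ... | no  _ = x

  patch-cong : ∀ c {x y} → x ≈ y → patch c x ≈ patch c y
  patch-cong c {x} {y} x≈y with x ≈? 0# | y ≈? 0#
  ... | yes _   | yes _   = refl
  ... | yes x≈0 | no  y≉0 = ⊥-elim (y≉0 (trans (sym x≈y) x≈0))
  ... | no  x≉0 | yes y≈0 = ⊥-elim (x≉0 (trans x≈y y≈0))
  ... | no  _   | no  _   = x≈y

  patch-zero : ∀ c {x} → x ≈ 0# → patch c x ≈ c
  patch-zero c {x} x≈0 with x ≈? 0#
  ... | yes _   = refl
  ... | no  x≉0 = ⊥-elim (x≉0 x≈0)

  patch-nonzero : ∀ c {x} → ¬ x ≈ 0# → patch c x ≈ x
  patch-nonzero c {x} x≉0 with x ≈? 0#
  ... | yes x≈0 = ⊥-elim (x≉0 x≈0)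
  ... | no  _   = refl

  patch-scale : ∀ {a} → ¬ a ≈ 0# → ∀ x → patch a (a * x) ≈ a * patch 1# x
  patch-scale {a} a≉0 x with x ≈? 0#
  ... | yes x≈0 = trans (patch-zero a (trans (*-congˡ x≈0) (zeroʳ a))) (sym (*-identityʳ a))
  ... | no  x≉0 = patch-nonzero a (*-nonzero a≉0 x≉0)

  -- the product of all nonzero elements of F, i.e. of all e j with j ≠ index 0
  nonzero-product : Carrier
  nonzero-product = Product.sum {m} (λ j → e (punchIn (index 0#) j))

  punchIn-nonzero : ∀ j → ¬ e (punchIn (index 0#) j) ≈ 0#
  punchIn-nonzero j e≈0 = FinP.punchInᵢ≢i (index 0#) j (P.trans (P.sym (index-e _)) (index-cong e≈0))

  nonzero-product-nonzero : ¬ nonzero-product ≈ 0#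
  nonzero-product-nonzero = product-nonzero punchIn-nonzero
    where
    product-nonzero : ∀ {k} {t : Fin k → Carrier} → (∀ j → ¬ t j ≈ 0#) → ¬ Product.sum t ≈ 0#
    product-nonzero {zero}  t≉0 1≈0 = 0≉1 (sym 1≈0)
    product-nonzero {suc k} t≉0 = *-nonzero (t≉0 Fin.zero) (product-nonzero (λ j → t≉0 (Fin.suc j)))

  product-patch : ∀ c → Product.sum {suc m} (λ i → patch c (e i)) ≈ c * nonzero-product
  product-patch c = begin
    Product.sum {suc m} (λ i → patch c (e i))
      ≈⟨ Product.sum-remove {i = index 0#} (λ i → patch c (e i)) ⟩
    patch c (e (index 0#)) * Product.sum {m} (λ j → patch c (e (punchIn (index 0#) j)))
      ≈⟨ *-cong (patch-zero c (e-index 0#)) (Product.sum-cong-≋ (λ j → patch-nonzero c (punchIn-nonzero j))) ⟩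
    c * nonzero-product ∎

  product-constant : ∀ k x → Product.sum {k} (λ _ → x) ≈ pow F x k
  product-constant zero    x = refl
  product-constant (suc k) x = *-congˡ (product-constant k x)

  -- with P the product of the nonzero elements and x ↦ a x a permutation of F:
  -- a P = Π_x patch a x = Π_x patch a (a x) = a^(suc m) P
  fermat-nonzero : ∀ a → ¬ a ≈ 0# → pow F a (suc m) ≈ a
  fermat-nonzero a a≉0 with inverse a a≉0
  ... | (a⁻¹ , aa⁻¹≈1) = sym (*-cancelˡ nonzero-product-nonzero (begin
    P * a                                          ≈⟨ *-comm P a ⟩
    a * P                                          ≈⟨ sym (product-patch a) ⟩
    Product.sum {suc m} (λ i → patch a (e i))      ≈⟨ Product.∑-permute (λ i → patch a (e i)) π ⟩
    Product.sum {suc m} (λ i → patch a (e (π ⟨$⟩ʳ i)))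
                                                   ≈⟨ Product.sum-cong-≋ (λ i → trans (patch-cong a (e-index _)) (patch-scale a≉0 (e i))) ⟩
    Product.sum {suc m} (λ i → a * patch 1# (e i)) ≈⟨ Product.∑-distrib-+ {suc m} (λ _ → a) (λ i → patch 1# (e i)) ⟩
    Product.sum {suc m} (λ _ → a) * Product.sum {suc m} (λ i → patch 1# (e i))
                                                   ≈⟨ *-cong (product-constant (suc m) a) (product-patch 1#) ⟩
    pow F a (suc m) * (1# * P)                     ≈⟨ trans (*-congˡ (*-identityˡ P)) (*-comm _ P) ⟩
    P * pow F a (suc m)                            ∎))
    where
    P = nonzero-product
    π = reindex (a *_) (a⁻¹ *_) *-congˡ *-congˡ
          (λ x → trans (sym (*-assoc a a⁻¹ x)) (trans (*-congʳ aa⁻¹≈1) (*-identityˡ x)))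
          (λ x → trans (sym (*-assoc a⁻¹ a x)) (trans (*-congʳ (trans (*-comm a⁻¹ a) aa⁻¹≈1)) (*-identityˡ x)))

  fermat : ∀ a → pow F a (suc m) ≈ a
  fermat a with a ≈? 0#
  ... | yes a≈0 = trans (pow-cong (suc m) a≈0) (trans (pow-zero m) (sym a≈0))
  ... | no  a≉0 = fermat-nonzero a a≉0

-- Monic polynomials over a field, given by their lower coefficients
-- [c₀, …, c_(d-1)], and the bound "at most d roots" for degree d.
module MonicPolynomials {c ℓ : Level} (F : CommutativeRing c ℓ) (isField : IsField F) where
  open CommutativeRing F
  open FieldLemmas F isField
  open IntegerRingSolver F using (solve; _:+_; _:*_; _:-_; _:=_)
  open import Algebra.Properties.Group +-group using (x∙y⁻¹≈ε⇒x≈y)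
  open import Data.Vec using (Vec; []; _∷_; replicate)
  open import Data.List using (List; []; _∷_; length)
  open import Data.List.Relation.Unary.All as All using (All; _∷_)
  open import Data.List.Relation.Unary.AllPairs using (_∷_)
  open import Data.List.Relation.Unary.Unique.Propositional using (Unique)
  open import Data.Fin using (Fin)
  open import Relation.Binary.Reasoning.Setoid setoid

  monic : ∀ {d} → Vec Carrier d → Carrier → Carrier
  monic []       x = 1#
  monic (c ∷ cs) x = c + x * monic cs x

  -- the quotient of division by X - r (synthetic division)
  quotient : ∀ {d} → Vec Carrier (suc d) → Carrier → Vec Carrier d
  quotient {zero}  (c ∷ [])  r = []
  quotient {suc d} (c ∷ cs)  r = monic cs r ∷ quotient cs r

  division : ∀ {d} (cs : Vec Carrier (suc d)) x r →
             monic cs x ≈ (x - r) * monic (quotient cs r) x + monic cs r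
  division {zero} (c ∷ []) x r =
    solve 4 (λ c x r o → c :+ x :* o := (x :- r) :* o :+ (c :+ r :* o)) refl c x r 1#
  division {suc d} (c ∷ cs) x r = begin
    c + x * monic cs x          ≈⟨ +-congˡ (*-congˡ (division cs x r)) ⟩
    c + x * ((x - r) * Q + A)   ≈⟨ solve 5 (λ c x r Q A → c :+ x :* ((x :- r) :* Q :+ A)
                                              := (x :- r) :* (A :+ x :* Q) :+ (c :+ r :* A)) refl c x r Q A ⟩
    (x - r) * (A + x * Q) + (c + r * A) ∎
    where
    Q = monic (quotient cs r) x
    A = monic cs r

  quotient-root : ∀ {d} (cs : Vec Carrier (suc d)) {r x} → ¬ x ≈ r →
                  monic cs r ≈ 0# → monic cs x ≈ 0# → monic (quotient cs r) x ≈ 0#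
  quotient-root cs {r} {x} x≉r root-r root-x = no-zero-divisors (λ x-r≈0 → x≉r (x∙y⁻¹≈ε⇒x≈y x r x-r≈0)) (begin
    (x - r) * monic (quotient cs r) x ≈⟨ solve 2 (λ a b → a := a :+ b :- b) refl _ (monic cs r) ⟩
    (x - r) * monic (quotient cs r) x + monic cs r - monic cs r ≈⟨ +-congʳ (sym (division cs x r)) ⟩
    monic cs x - monic cs r ≈⟨ +-cong root-x (-‿cong root-r) ⟩
    0# - 0#                 ≈⟨ -‿inverseʳ 0# ⟩
    0#                      ∎)

  module RootBound {n : ℕ} (e : Fin n → Carrier) (e-injective : ∀ {i j} → e i ≈ e j → i ≡ j) where
    root-bound : ∀ {d} (cs : Vec Carrier d) (xs : List (Fin n)) → Unique xs →
                 All (λ i → monic cs (e i) ≈ 0#) xs → length xs ≤ d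
    root-bound cs       []       _             _              = z≤n
    root-bound []       (i ∷ is) _             (1≈0 ∷ _)      = ⊥-elim (0≉1 (sym 1≈0))
    root-bound (c ∷ cs) (i ∷ is) (i∉is ∷ uniq) (root-i ∷ roots) =
      s≤s (root-bound (quotient (c ∷ cs) (e i)) is uniq (All.zipWith quotient-root-at (i∉is , roots)))
      where
      quotient-root-at : ∀ {j} → ¬ i ≡ j × monic (c ∷ cs) (e j) ≈ 0# → monic (quotient (c ∷ cs) (e i)) (e j) ≈ 0#
      quotient-root-at (i≢j , root-j) = quotient-root (c ∷ cs) (λ ej≈ei → i≢j (P.sym (e-injective ej≈ei))) root-i root-j

  monic-power : ∀ k x → monic (replicate k 0#) x ≈ pow F x k
  monic-power zero    x = refl
  monic-power (suc k) x = trans (+-identityˡ _) (*-congˡ (monic-power k x))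

  binomial : ∀ k → Carrier → Vec Carrier (suc k)
  binomial k c = (- c) ∷ replicate k 0#

  binomial-root : ∀ k c x → pow F x (suc k) ≈ c → monic (binomial k c) x ≈ 0#
  binomial-root k c x x^[k+1]≈c = begin
    - c + x * monic (replicate k 0#) x ≈⟨ +-congˡ (*-congˡ (monic-power k x)) ⟩
    - c + pow F x (suc k)              ≈⟨ +-congˡ x^[k+1]≈c ⟩
    - c + c                            ≈⟨ -‿inverseˡ c ⟩
    0#                                 ∎

  trinomial : ∀ k → Carrier → Carrier → Vec Carrier (suc (suc k))
  trinomial k a b = b ∷ a ∷ replicate k 0#

  trinomial-root : ∀ k a b x → b + x * (a + x * pow F x k) ≈ 0# → monic (trinomial k a b) x ≈ 0#
  trinomial-root k a b x root = trans (+-congˡ (*-congˡ (+-congˡ (*-congˡ (monic-power k x))))) root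

module FibreCounting {n : ℕ} where
  open import Data.Fin as Fin using (Fin)
  open import Data.List using (List; []; _∷_; length; filter)
  open import Data.List.Membership.Propositional using (_∈_)
  open import Data.List.Relation.Unary.Any using (here; there)
  open import Data.List.Relation.Unary.AllPairs using (_∷_)
  open import Data.List.Relation.Unary.All using (_∷_)
  open import Data.List.Relation.Unary.Unique.Propositional using (Unique)
  open import Algebra.Properties.CommutativeSemigroup ℕP.+-commutativeSemigroup using (interchange)
  open ℕP.≤-Reasoning

  sumOver : List (Fin n) → (Fin n → ℕ) → ℕ
  sumOver []       f = 0
  sumOver (b ∷ bs) f = f b ℕ.+ sumOver bs f

  fibre : (Fin n → Fin n) → Fin n → List (Fin n) → List (Fin n)
  fibre φ b A = filter (λ a → φ a Fin.≟ b) A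

  -- each element a ∈ A contributes exactly one to the fibre sizes, at b = φ a
  indicator : Fin n → Fin n → ℕ
  indicator x b with x Fin.≟ b
  ... | yes _ = 1
  ... | no  _ = 0

  fibre-cons : ∀ φ b a A → length (fibre φ b (a ∷ A)) ≡ indicator (φ a) b ℕ.+ length (fibre φ b A)
  fibre-cons φ b a A with φ a Fin.≟ b
  ... | yes _ = P.refl
  ... | no  _ = P.refl

  sumOver-cong : ∀ I {f g : Fin n → ℕ} → (∀ b → f b ≡ g b) → sumOver I f ≡ sumOver I g
  sumOver-cong []      f≗g = P.refl
  sumOver-cong (b ∷ I) f≗g = P.cong₂ ℕ._+_ (f≗g b) (sumOver-cong I f≗g)

  sumOver-+ : ∀ I f g → sumOver I (λ b → f b ℕ.+ g b) ≡ sumOver I f ℕ.+ sumOver I g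
  sumOver-+ []      f g = P.refl
  sumOver-+ (b ∷ I) f g = P.trans (P.cong (f b ℕ.+ g b ℕ.+_) (sumOver-+ I f g))
                                  (interchange (f b) (g b) (sumOver I f) (sumOver I g))

  sumOver-indicator : ∀ x I → x ∈ I → 1 ≤ sumOver I (indicator x)
  sumOver-indicator x (b ∷ I) (here P.refl) with x Fin.≟ x
  ... | yes _   = s≤s z≤n
  ... | no  x≢x = ⊥-elim (x≢x P.refl)
  sumOver-indicator x (b ∷ I) (there x∈I) = ℕP.≤-trans (sumOver-indicator x I x∈I) (ℕP.m≤n+m _ _)

  length≤sum-fibres : ∀ (φ : Fin n → Fin n) (A I : List (Fin n)) → (∀ {a} → a ∈ A → φ a ∈ I) →
                      length A ≤ sumOver I (λ b → length (fibre φ b A))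
  length≤sum-fibres φ []      I maps-into = z≤n
  length≤sum-fibres φ (a ∷ A) I maps-into = begin
    suc (length A)
      ≤⟨ ℕP.+-mono-≤ (sumOver-indicator (φ a) I (maps-into (here P.refl)))
                     (length≤sum-fibres φ A I (λ a∈A → maps-into (there a∈A))) ⟩
    sumOver I (indicator (φ a)) ℕ.+ sumOver I (λ b → length (fibre φ b A))
      ≡⟨ P.sym (sumOver-+ I (indicator (φ a)) (λ b → length (fibre φ b A))) ⟩
    sumOver I (λ b → indicator (φ a) b ℕ.+ length (fibre φ b A))
      ≡⟨ sumOver-cong I (λ b → P.sym (fibre-cons φ b a A)) ⟩
    sumOver I (λ b → length (fibre φ b (a ∷ A))) ∎

  sumOver-≤ : ∀ I f k → (∀ b → f b ≤ k) → sumOver I f ≤ length I ℕ.* k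
  sumOver-≤ []      f k f≤k = z≤n
  sumOver-≤ (b ∷ I) f k f≤k = ℕP.+-mono-≤ (f≤k b) (sumOver-≤ I f k f≤k)

  sumOver-< : ∀ I f b₀ → b₀ ∈ I → f b₀ ≤ 1 → (∀ b → f b ≤ 2) → suc (sumOver I f) ≤ length I ℕ.* 2
  sumOver-< (b ∷ I) f b₀ (here P.refl) fb₀≤1 f≤2 = ℕP.+-mono-≤ (s≤s fb₀≤1) (sumOver-≤ I f 2 f≤2)
  sumOver-< (b ∷ I) f b₀ (there b₀∈I)  fb₀≤1 f≤2 = begin
    suc (f b ℕ.+ sumOver I f) ≡⟨ P.sym (ℕP.+-suc (f b) (sumOver I f)) ⟩
    f b ℕ.+ suc (sumOver I f) ≤⟨ ℕP.+-mono-≤ (f≤2 b) (sumOver-< I f b₀ b₀∈I fb₀≤1 f≤2) ⟩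
    2 ℕ.+ length I ℕ.* 2      ∎

  at-most-one : ∀ {j} (xs : List (Fin n)) → Unique xs → (∀ {i} → i ∈ xs → i ≡ j) → length xs ≤ 1
  at-most-one []           _                 _     = z≤n
  at-most-one (x ∷ [])     _                 _     = s≤s z≤n
  at-most-one (x ∷ y ∷ xs) ((x≢y ∷ _) ∷ _) all≡j =
    ⊥-elim (x≢y (P.trans (all≡j (here P.refl)) (P.sym (all≡j (there (here P.refl))))))

  two-elements : ∀ (xs : List (Fin n)) → Unique xs → ¬ length xs ≤ 1 → ∃[ i ] ∃[ j ] i ∈ xs × j ∈ xs × ¬ i ≡ j
  two-elements []          _                 ≰1 = ⊥-elim (≰1 z≤n)
  two-elements (x ∷ [])    _                 ≰1 = ⊥-elim (≰1 (s≤s z≤n))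
  two-elements (x ∷ y ∷ _) ((x≢y ∷ _) ∷ _) _  = x , y , here P.refl , there (here P.refl) , x≢y

  empty : ∀ (xs : List (Fin n)) → (∀ {i} → ¬ i ∈ xs) → length xs ≡ 0
  empty []      _     = P.refl
  empty (x ∷ _) ∉xs = ⊥-elim (∉xs (here P.refl))

  counting-bound : ∀ (φ : Fin n → Fin n) (A I : List (Fin n)) k → (∀ {a} → a ∈ A → φ a ∈ I) →
                   (∀ b → length (fibre φ b A) ≤ k) → length A ≤ length I ℕ.* k
  counting-bound φ A I k maps-into fibres≤k =
    ℕP.≤-trans (length≤sum-fibres φ A I maps-into) (sumOver-≤ I _ k fibres≤k)

-- The numerical inequalities of the counting argument, for q = r + 2.
module CountingArithmetic where
  open import Data.Nat using (_*_; _+_)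
  open import Data.Nat.Solver using (module +-*-Solver)
  open +-*-Solver using (solve; _:+_; _:*_; _:=_; con)
  open ℕP.≤-Reasoning

  bound-from-norm-fibres : ∀ r L → suc (suc r) * suc (suc r) ≤ suc L * suc (suc (suc r)) → suc r ≤ L
  bound-from-norm-fibres r L q²≤ = ℕP.≮⇒≥ (λ L<q-1 → ℕP.<⇒≱ (too-small (ℕP.≤-pred L<q-1)) q²≤)
    where
    too-small : L ≤ r → suc L * suc (suc (suc r)) < suc (suc r) * suc (suc r)
    too-small L≤r = begin-strict
      suc L * suc (suc (suc r))       ≤⟨ ℕP.*-monoˡ-≤ (suc (suc (suc r))) (s≤s L≤r) ⟩
      suc r * suc (suc (suc r))       <⟨ ℕP.n<1+n _ ⟩
      suc (suc r * suc (suc (suc r))) ≡⟨ solve 1 (λ r → con 1 :+ (con 1 :+ r) :* (con 3 :+ r)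
                                                    := (con 2 :+ r) :* (con 2 :+ r)) P.refl r ⟩
      suc (suc r) * suc (suc r)       ∎

  bound-from-W-fibres : ∀ r L → suc (suc r) * suc (suc r) ≤ suc L * suc r → suc (suc (suc r)) ≤ L
  bound-from-W-fibres r L q²≤ = ℕP.≮⇒≥ (λ L<q+1 → ℕP.<⇒≱ (too-small (ℕP.≤-pred L<q+1)) q²≤)
    where
    too-small : L ≤ suc (suc r) → suc L * suc r < suc (suc r) * suc (suc r)
    too-small L≤q = begin-strict
      suc L * suc r                   ≤⟨ ℕP.*-monoˡ-≤ (suc r) (s≤s L≤q) ⟩
      suc (suc (suc r)) * suc r       <⟨ ℕP.n<1+n _ ⟩
      suc (suc (suc (suc r)) * suc r) ≡⟨ solve 1 (λ r → con 1 :+ (con 3 :+ r) :* (con 1 :+ r)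
                                                    := (con 2 :+ r) :* (con 2 :+ r)) P.refl r ⟩
      suc (suc r) * suc (suc r)       ∎

  pigeonhole : ∀ r LW LQ LI → suc r ≤ LQ → suc (suc (suc r)) ≤ LW → LI ≤ suc (suc r) →
               suc (LW + LQ) ≤ LI * 2 → ⊥
  pigeonhole r LW LQ LI q-1≤LQ q+1≤LW LI≤q = ℕP.<⇒≱ (begin-strict
    LI * 2                      ≤⟨ ℕP.*-monoˡ-≤ 2 LI≤q ⟩
    suc (suc r) * 2             ≡⟨ solve 1 (λ r → (con 2 :+ r) :* con 2 := (con 3 :+ r) :+ (con 1 :+ r)) P.refl r ⟩
    suc (suc (suc r)) + suc r   ≤⟨ ℕP.+-mono-≤ q+1≤LW q-1≤LQ ⟩
    LW + LQ                     <⟨ ℕP.n<1+n _ ⟩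
    suc (LW + LQ)               ∎)

-- The setting of Theorem 3.2: F is a field with q² elements, where
-- q = r + 2 = p^(k+1) for the prime p = p′ + 1.
module Setting {c ℓ : Level} (F : CommutativeRing c ℓ) (isField : IsField F)
               (r p′ k : ℕ) (p-prime : Prime (suc p′))
               (q≡p^[k+1] : suc (suc r) ≡ suc p′ ℕ.^ suc k)
               (card : HasCard F (suc (suc r) ℕ.* suc (suc r))) where
  open CommutativeRing F
  open PowerLaws F
  open FieldLemmas F isField
  open IntegerRingSolver F using (solve; _:+_; _:*_; _:-_; :-_; _:=_)
  open import Algebra.Properties.Group +-group using (x∙y⁻¹≈ε⇒x≈y; x≈y⇒x∙y⁻¹≈ε; ε⁻¹≈ε)
  open import Algebra.Properties.Semiring.Mult semiring using (×1-homo-*) renaming (_×_ to _×ₙ_)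
  open MonicPolynomials F isField
  open CountingArithmetic using (bound-from-norm-fibres)
  open import Data.Fin as Fin using (Fin)
  import Data.Fin.Properties as FinP
  open import Data.Vec using (Vec)
  open import Data.List using (List; _∷_; _++_; length; filter; allFin)
  import Data.List.Properties as LP
  open import Data.List.Membership.Propositional using (_∈_)
  open import Data.List.Membership.Propositional.Properties using (∈-filter⁺; ∈-filter⁻; ∈-allFin)
  open import Data.List.Relation.Unary.Any using (here; there)
  import Data.List.Relation.Unary.All as All
  import Data.List.Relation.Unary.All.Properties as AllP
  open import Data.List.Relation.Unary.Unique.Propositional using (Unique)
  import Data.List.Relation.Unary.Unique.Propositional.Properties as UniqueP
  open import Relation.Unary using (Decidable)
  open import Relation.Nullary.Decidable using (¬?; _×-dec_)
  open import Function using (_∘_)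
  open import Relation.Binary.Reasoning.Setoid setoid

  q : ℕ
  q = suc (suc r)

  p : ℕ
  p = suc p′

  -- |F| = q² = suc m
  m : ℕ
  m = suc (r ℕ.+ suc r ℕ.* q)

  open FiniteField F isField m card
  open FibreCounting {suc m} using (fibre; counting-bound)
  open import Data.List.Membership.DecPropositional (Fin._≟_ {suc m}) using (_∈?_)

  -- F has characteristic p: (q · 1)² = q² · 1 = 0, and q · 1 = (p · 1)^(k+1)
  characteristic-p : p ×ₙ 1# ≈ 0#
  characteristic-p = nilpotent⇒zero (suc k) (begin
    pow F (p ×ₙ 1#) (suc k) ≈⟨ sym (power-of-p (suc k)) ⟩
    (p ℕ.^ suc k) ×ₙ 1#    ≡⟨ P.cong (_×ₙ 1#) (P.sym q≡p^[k+1]) ⟩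
    q ×ₙ 1#                ≈⟨ nilpotent⇒zero 2 (trans (*-congˡ (*-identityʳ _)) q·1²≈0) ⟩
    0#                     ∎)
    where
    power-of-p : ∀ j → (p ℕ.^ j) ×ₙ 1# ≈ pow F (p ×ₙ 1#) j
    power-of-p zero    = +-identityʳ 1#
    power-of-p (suc j) = trans (×1-homo-* p (p ℕ.^ j)) (*-congˡ (power-of-p j))
    q·1²≈0 : (q ×ₙ 1#) * (q ×ₙ 1#) ≈ 0#
    q·1²≈0 = trans (sym (×1-homo-* q q)) characteristic

  Fr : Carrier → Carrier
  Fr x = pow F x q

  Fr-+ : ∀ x y → Fr (x + y) ≈ Fr x + Fr y
  Fr-+ x y = P.subst (λ n → pow F (x + y) n ≈ pow F x n + pow F y n) (P.sym q≡p^[k+1])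
                     (Frobenius.frobenius-iterate F p′ p-prime characteristic-p (suc k) x y)

  Fr-* : ∀ x y → Fr (x * y) ≈ Fr x * Fr y
  Fr-* x y = pow-distrib-* x y q

  Fr-involutive : ∀ x → Fr (Fr x) ≈ x
  Fr-involutive x = trans (sym (pow-* x q q)) (fermat x)

  Fr-0 : Fr 0# ≈ 0#
  Fr-0 = pow-zero (suc r)

  Fr-neg : ∀ x → Fr (- x) ≈ - Fr x
  Fr-neg x = begin
    Fr (- x)                 ≈⟨ solve 2 (λ a b → b := (a :+ b) :- a) refl (Fr x) (Fr (- x)) ⟩
    (Fr x + Fr (- x)) - Fr x ≈⟨ +-congʳ (sym (Fr-+ x (- x))) ⟩
    Fr (x - x) - Fr x        ≈⟨ +-congʳ (trans (pow-cong q (-‿inverseʳ x)) Fr-0) ⟩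
    0# - Fr x                ≈⟨ +-identityˡ _ ⟩
    - Fr x                   ∎

  trace-in-Fq : ∀ x → Fr (x + Fr x) ≈ x + Fr x
  trace-in-Fq x = trans (Fr-+ x (Fr x)) (trans (+-congˡ (Fr-involutive x)) (+-comm _ _))

  norm-in-Fq : ∀ x → Fr (x * Fr x) ≈ x * Fr x
  norm-in-Fq x = trans (Fr-* x (Fr x)) (trans (*-congˡ (Fr-involutive x)) (*-comm _ _))

  zero-sum : ∀ {a b} → a ≈ 0# → b ≈ 0# → a + b ≈ 0#
  zero-sum a≈0 b≈0 = trans (+-cong a≈0 b≈0) (+-identityʳ 0#)

  unit-power : ∀ x → ¬ x ≈ 0# → pow F x m ≈ 1#
  unit-power x x≉0 = *-cancelˡ x≉0 (trans (fermat x) (sym (*-identityʳ x)))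

  open RootBound e e-injective

  -- Subsets of F are represented by duplicate-free lists of indices.
  indices : List (Fin (suc m))
  indices = allFin (suc m)

  length-indices : length indices ≡ suc m
  length-indices = LP.length-tabulate (λ i → i)

  indicesWith : {P : Fin (suc m) → Set ℓ} → Decidable P → List (Fin (suc m))
  indicesWith P? = filter P? indices

  indicesWith-unique : {P : Fin (suc m) → Set ℓ} (P? : Decidable P) → Unique (indicesWith P?)
  indicesWith-unique P? = UniqueP.filter⁺ P? (UniqueP.allFin⁺ (suc m))

  ∈-indicesWith⁺ : {P : Fin (suc m) → Set ℓ} (P? : Decidable P) → ∀ {j} → P j → j ∈ indicesWith P?
  ∈-indicesWith⁺ P? Pj = ∈-filter⁺ P? (∈-allFin _) Pj

  ∈-indicesWith⁻ : {P : Fin (suc m) → Set ℓ} (P? : Decidable P) → ∀ {j} → j ∈ indicesWith P? → P j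
  ∈-indicesWith⁻ P? j∈ = proj₂ (∈-filter⁻ P? {xs = indices} j∈)

  ∈-fibre⁻ : ∀ (h : Carrier → Carrier) {b j A} → j ∈ fibre (λ i → index (h (e i))) b A → j ∈ A × h (e j) ≈ e b
  ∈-fibre⁻ h {b} {j} {A} j∈ with ∈-filter⁻ (λ a → index (h (e a)) Fin.≟ b) {xs = A} j∈
  ... | (j∈A , index≡b) = j∈A , trans (sym (e-index _)) (reflexive (P.cong e index≡b))

  fibre-unique : ∀ φ b {A} → Unique A → Unique (fibre φ b A)
  fibre-unique φ b = UniqueP.filter⁺ (λ a → φ a Fin.≟ b)

  fibre-root-bound : ∀ {d} (cs : Vec Carrier d) φ b {A} → Unique A →
                     (∀ {j} → j ∈ fibre φ b A → monic cs (e j) ≈ 0#) → length (fibre φ b A) ≤ d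
  fibre-root-bound cs φ b uniq roots = root-bound cs _ (fibre-unique φ b uniq) (All.tabulate roots)

  whole-field-bound : ∀ (h : Carrier → Carrier) (I : List (Fin (suc m))) d →
                      (∀ x → ¬ h x ≈ 0# → index (h x) ∈ I) →
                      (∀ b → length (fibre (λ i → index (h (e i))) b indices) ≤ d) →
                      q ℕ.* q ≤ suc (length I) ℕ.* d
  whole-field-bound h I d lands-in fibres≤d = P.subst (_≤ suc (length I) ℕ.* d) length-indices
    (counting-bound (λ i → index (h (e i))) indices (index 0# ∷ I) d maps-into fibres≤d)
    where
    maps-into : ∀ {a} → a ∈ indices → index (h (e a)) ∈ index 0# ∷ I
    maps-into {a} _ with h (e a) ≈? 0#
    ... | yes ha≈0 = here (index-cong ha≈0)
    ... | no  ha≉0 = there (lands-in (e a) ha≉0)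

  InFq? : Decidable (λ j → Fr (e j) ≈ e j)
  InFq? j = Fr (e j) ≈? e j

  Fq : List (Fin (suc m))
  Fq = indicesWith InFq?

  InFq*? : Decidable (λ j → (¬ e j ≈ 0#) × (Fr (e j) ≈ e j))
  InFq*? j = ¬? (e j ≈? 0#) ×-dec InFq? j

  Fq* : List (Fin (suc m))
  Fq* = indicesWith InFq*?

  Fq*-unique : Unique Fq*
  Fq*-unique = indicesWith-unique InFq*?

  index-in-Fq : ∀ v → Fr v ≈ v → index v ∈ Fq
  index-in-Fq v v∈Fq = ∈-indicesWith⁺ InFq? (trans (pow-cong q (e-index v)) (trans v∈Fq (sym (e-index v))))

  -- F_q consists of roots of X^q - X
  Fq-size : length Fq ≤ q
  Fq-size = root-bound (trinomial r (- 1#) 0#) Fq (indicesWith-unique InFq?)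
                       (All.tabulate (λ j∈ → root (∈-indicesWith⁻ InFq? j∈)))
    where
    root : ∀ {j} → Fr (e j) ≈ e j → monic (trinomial r (- 1#) 0#) (e j) ≈ 0#
    root {j} x∈Fq = trinomial-root r (- 1#) 0# x (begin
      0# + x * (- 1# + x * pow F x r) ≈⟨ solve 4 (λ z x u P → z :+ x :* (:- u :+ x :* P) := x :* (x :* P) :- x :* u :+ z) refl 0# x 1# (pow F x r) ⟩
      Fr x - x * 1# + 0#             ≈⟨ +-identityʳ _ ⟩
      Fr x - x * 1#                  ≈⟨ x≈y⇒x∙y⁻¹≈ε (trans x∈Fq (sym (*-identityʳ x))) ⟩
      0#                             ∎)
      where x = e j

  -- the norm x ↦ x^(q+1) maps F* into F_q* with fibres of size ≤ q + 1
  Fq*-size : suc r ≤ length Fq*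
  Fq*-size = bound-from-norm-fibres r (length Fq*) (whole-field-bound norm Fq* (suc q) norm-in-Fq* fibre-bound)
    where
    norm : Carrier → Carrier
    norm x = pow F x (suc q)
    norm-in-Fq* : ∀ x → ¬ norm x ≈ 0# → index (norm x) ∈ Fq*
    norm-in-Fq* x nx≉0 = ∈-indicesWith⁺ InFq*? (nx≉0 ∘ trans (sym (e-index _)) ,
      trans (pow-cong q (e-index _)) (trans (norm-in-Fq x) (sym (e-index _))))
    fibre-bound : ∀ b → length (fibre (λ i → index (norm (e i))) b indices) ≤ suc q
    fibre-bound b = fibre-root-bound (binomial q (e b)) (λ i → index (norm (e i))) b (UniqueP.allFin⁺ (suc m))
      (λ j∈ → binomial-root q (e b) _ (proj₂ (∈-fibre⁻ norm j∈)))

  module Coefficients (a0 a1 : Carrier) where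
    T : Carrier
    T = Tr F q a0

    N : Carrier
    N = pow F a1 (suc q)

    -- L(X)/X without the constant term: W x = a1 x^(q-1)
    W : Carrier → Carrier
    W x = a1 * pow F x (suc r)

    g : Carrier → Carrier
    g = gPoly F q a0 a1

    NoRoot : Set (c Level.⊔ ℓ)
    NoRoot = ∀ x → ¬ x ≈ 0# → ¬ fTr F q a0 a1 x ≈ 0#

    TwoRootsInFq : Set (c Level.⊔ ℓ)
    TwoRootsInFq = ∃[ y ] ∃[ z ] InSubfield F q y × InSubfield F q z × ¬ y ≈ z × g y ≈ 0# × g z ≈ 0#

    T-in-Fq : Fr T ≈ T
    T-in-Fq = trace-in-Fq a0

    N-in-Fq : Fr N ≈ N
    N-in-Fq = norm-in-Fq a1

    f≈trace : ∀ x → fTr F q a0 a1 x ≈ (W x + Fr (W x)) + T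
    f≈trace x = begin
      (W x + a0) + Fr (W x + a0)      ≈⟨ +-congˡ (Fr-+ (W x) a0) ⟩
      (W x + a0) + (Fr (W x) + Fr a0) ≈⟨ solve 4 (λ a b c d → (a :+ b) :+ (c :+ d) := (a :+ c) :+ (b :+ d)) refl (W x) a0 (Fr (W x)) (Fr a0) ⟩
      (W x + Fr (W x)) + T            ∎

    -- for x ≠ 0 the norm of W x is N, since x^(q-1) · x^(q(q-1)) = x^(q²-1) = 1
    W-norm : ∀ x → ¬ x ≈ 0# → W x * Fr (W x) ≈ N
    W-norm x x≉0 = begin
      W x * Fr (W x)                                   ≈⟨ *-congˡ (Fr-* a1 (pow F x (suc r))) ⟩
      (a1 * pow F x (suc r)) * (Fr a1 * Fr (pow F x (suc r)))
        ≈⟨ solve 4 (λ a b c d → (a :* b) :* (c :* d) := (a :* c) :* (b :* d)) refl a1 (pow F x (suc r)) (Fr a1) (Fr (pow F x (suc r))) ⟩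
      N * (pow F x (suc r) * pow F (pow F x (suc r)) q) ≈⟨ *-congˡ (*-congˡ (sym (pow-* x (suc r) q))) ⟩
      N * (pow F x (suc r) * pow F x (suc r ℕ.* q))     ≈⟨ *-congˡ (sym (pow-+ x (suc r) (suc r ℕ.* q))) ⟩
      N * pow F x m                                    ≈⟨ *-congˡ (unit-power x x≉0) ⟩
      N * 1#                                           ≈⟨ *-identityʳ N ⟩
      N                                                ∎

    f-root : ∀ x → fTr F q a0 a1 x ≈ 0# → W x + Fr (W x) + T ≈ 0#
    f-root x fx≈0 = trans (sym (f≈trace x)) fx≈0

    module Backward (y z : Carrier) (y∈Fq : Fr y ≈ y) (z∈Fq : Fr z ≈ z) (y≉z : ¬ y ≈ z)
                    (gy≈0 : g y ≈ 0#) (gz≈0 : g z ≈ 0#) where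

      -- Vieta: y + z = -T and y z = N
      sum-of-roots : y + z + T ≈ 0#
      sum-of-roots = no-zero-divisors (λ y-z≈0 → y≉z (x∙y⁻¹≈ε⇒x≈y y z y-z≈0)) (begin
        (y - z) * (y + z + T) ≈⟨ solve 4 (λ y z T N → (y :- z) :* (y :+ z :+ T)
                                   := (y :* y :+ T :* y :+ N) :- (z :* z :+ T :* z :+ N)) refl y z T N ⟩
        g y - g z             ≈⟨ +-cong gy≈0 (-‿cong gz≈0) ⟩
        0# - 0#               ≈⟨ -‿inverseʳ 0# ⟩
        0#                    ∎)

      product-of-roots : y * z - N ≈ 0#
      product-of-roots = begin
        y * z - N             ≈⟨ solve 4 (λ y z T N → y :* z :- N := y :* (y :+ z :+ T) :- (y :* y :+ T :* y :+ N)) refl y z T N ⟩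
        y * (y + z + T) - g y ≈⟨ +-cong (trans (*-congˡ sum-of-roots) (zeroʳ y)) (-‿cong gy≈0) ⟩
        0# - 0#               ≈⟨ -‿inverseʳ 0# ⟩
        0#                    ∎

      trace-norm-root : ∀ w → w + Fr w + T ≈ 0# → w * Fr w ≈ N → (w - y) * (w - z) ≈ 0#
      trace-norm-root w trace norm = begin
        (w - y) * (w - z)
          ≈⟨ solve 6 (λ w y z T N Fw → (w :- y) :* (w :- z) := (:- (y :+ z :+ T)) :* w :+ (w :+ Fw :+ T) :* w
                                                                :+ (y :* z :- N) :+ (N :- w :* Fw)) refl w y z T N (Fr w) ⟩
        (- (y + z + T)) * w + (w + Fr w + T) * w + (y * z - N) + (N - w * Fr w)
          ≈⟨ zero-sum (zero-sum (zero-sum first second) product-of-roots) (x≈y⇒x∙y⁻¹≈ε (sym norm)) ⟩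
        0# ∎
        where
        first : (- (y + z + T)) * w ≈ 0#
        first = trans (*-congʳ (trans (-‿cong sum-of-roots) ε⁻¹≈ε)) (zeroˡ w)
        second : (w + Fr w + T) * w ≈ 0#
        second = trans (*-congʳ trace) (zeroˡ w)

      -- but w = v ∈ F_q with Tr v = 2v = -T = v + u forces v = u
      root-in-Fq-collapses : ∀ {w} v u → Fr v ≈ v → v + u + T ≈ 0# → ¬ v ≈ u → w + Fr w + T ≈ 0# → w ≈ v → ⊥
      root-in-Fq-collapses {w} v u v∈Fq v+u+T≈0 v≉u trace w≈v = v≉u (x∙y⁻¹≈ε⇒x≈y v u (begin
        v - u                         ≈⟨ solve 3 (λ v u T → v :- u := (v :+ v :+ T) :- (v :+ u :+ T)) refl v u T ⟩
        (v + v + T) - (v + u + T)     ≈⟨ +-cong v+v+T≈0 (-‿cong v+u+T≈0) ⟩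
        0# - 0#                       ≈⟨ -‿inverseʳ 0# ⟩
        0#                            ∎))
        where
        v+v+T≈0 : v + v + T ≈ 0#
        v+v+T≈0 = trans (+-congʳ (+-cong (sym w≈v) (trans (sym v∈Fq) (pow-cong q (sym w≈v))))) trace

      no-root : ∀ x → ¬ x ≈ 0# → ¬ fTr F q a0 a1 x ≈ 0#
      no-root x x≉0 fx≈0 with W x ≈? y
      ... | yes w≈y = root-in-Fq-collapses y z y∈Fq sum-of-roots y≉z trace w≈y
        where trace = f-root x fx≈0
      ... | no  w≉y = root-in-Fq-collapses z y z∈Fq (trans (+-congʳ (+-comm z y)) sum-of-roots) (λ z≈y → y≉z (sym z≈y)) trace w≈z
        where
        trace = f-root x fx≈0
        w≈z : W x ≈ z
        w≈z = x∙y⁻¹≈ε⇒x≈y _ z (no-zero-divisors (λ w-y≈0 → w≉y (x∙y⁻¹≈ε⇒x≈y _ y w-y≈0))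
                                   (trace-norm-root (W x) trace (W-norm x x≉0)))

    -- (⇒) for a1 = 0: f is the constant T, so T ≠ 0, and g y = y (y + T) has
    -- the distinct roots 0 and -T in F_q
    degenerate-case : a1 ≈ 0# → NoRoot → TwoRootsInFq
    degenerate-case a1≈0 no-root = 0# , - T , Fr-0 , trans (Fr-neg T) (-‿cong T-in-Fq) , 0≉-T , g0≈0 , g-T≈0
      where
      N≈0 : N ≈ 0#
      N≈0 = trans (*-congʳ a1≈0) (zeroˡ _)
      W≈0 : ∀ x → W x ≈ 0#
      W≈0 x = trans (*-congʳ a1≈0) (zeroˡ _)
      f1≈T : fTr F q a0 a1 1# ≈ T
      f1≈T = trans (f≈trace 1#) (trans (+-congʳ (trans (+-cong (W≈0 1#) (trans (pow-cong q (W≈0 1#)) Fr-0))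
                                                        (+-identityʳ 0#)))
                                       (+-identityˡ T))
      0≉-T : ¬ 0# ≈ - T
      0≉-T 0≈-T = no-root 1# (λ 1≈0 → 0≉1 (sym 1≈0))
                    (trans f1≈T (trans (sym (+-identityʳ T)) (trans (+-congˡ 0≈-T) (-‿inverseʳ T))))
      g0≈0 : g 0# ≈ 0#
      g0≈0 = trans (+-cong (trans (+-cong (zeroˡ 0#) (zeroʳ T)) (+-identityʳ 0#)) N≈0) (+-identityʳ 0#)
      g-T≈0 : g (- T) ≈ 0#
      g-T≈0 = trans (+-congˡ N≈0) (trans (+-identityʳ _) (begin
        - T * - T + T * - T ≈⟨ solve 1 (λ T → :- T :* :- T :+ T :* :- T := T :- T) refl T ⟩
        T - T               ≈⟨ -‿inverseʳ T ⟩
        0#                  ∎))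

    module Counting (a1≉0 : ¬ a1 ≈ 0#) (no-root : NoRoot) where
      open FibreCounting {suc m} using (sumOver; sumOver-+; length≤sum-fibres; sumOver-<; at-most-one; two-elements; empty)
      open CountingArithmetic using (bound-from-W-fibres; pigeonhole)

      IsWValue : Fin (suc m) → Set ℓ
      IsWValue j = ∃ λ i → (¬ e i ≈ 0#) × (W (e i) ≈ e j)

      IsWValue? : Decidable IsWValue
      IsWValue? j = FinP.any? (λ i → ¬? (e i ≈? 0#) ×-dec (W (e i) ≈? e j))

      WValues : List (Fin (suc m))
      WValues = indicesWith IsWValue?

      WValues-unique : Unique WValues
      WValues-unique = indicesWith-unique IsWValue?

      WValue-norm : ∀ {j} → IsWValue j → e j * Fr (e j) ≈ N
      WValue-norm (i , ei≉0 , W≈ej) = trans (*-cong (sym W≈ej) (pow-cong q (sym W≈ej))) (W-norm (e i) ei≉0)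

      -- W x = c has at most q - 1 solutions, being roots of X^(q-1) - c / a1
      WValues-size : suc (suc (suc r)) ≤ length WValues
      WValues-size = bound-from-W-fibres r (length WValues) (whole-field-bound W WValues (suc r) W-lands fibre-bound)
        where
        a1⁻¹ = proj₁ (inverse a1 a1≉0)
        a1a1⁻¹≈1 = proj₂ (inverse a1 a1≉0)
        W-lands : ∀ x → ¬ W x ≈ 0# → index (W x) ∈ WValues
        W-lands x Wx≉0 = ∈-indicesWith⁺ IsWValue?
          (index x , ex≉0 , trans (*-congˡ (pow-cong (suc r) (e-index x))) (sym (e-index _)))
          where
          ex≉0 : ¬ e (index x) ≈ 0#
          ex≉0 ex≈0 = Wx≉0 (trans (*-congˡ (pow-cong (suc r) (trans (sym (e-index x)) ex≈0)))
                                  (trans (*-congˡ (pow-zero r)) (zeroʳ a1)))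
        solve-for-power : ∀ {x c} → W x ≈ c → pow F x (suc r) ≈ a1⁻¹ * c
        solve-for-power {x} {c} Wx≈c = begin
          pow F x (suc r)              ≈⟨ sym (*-identityˡ _) ⟩
          1# * pow F x (suc r)         ≈⟨ *-congʳ (sym (trans (*-comm a1⁻¹ a1) a1a1⁻¹≈1)) ⟩
          (a1⁻¹ * a1) * pow F x (suc r) ≈⟨ *-assoc a1⁻¹ a1 _ ⟩
          a1⁻¹ * W x                   ≈⟨ *-congˡ Wx≈c ⟩
          a1⁻¹ * c                     ∎
        fibre-bound : ∀ b → length (fibre (λ i → index (W (e i))) b indices) ≤ suc r
        fibre-bound b = fibre-root-bound (binomial r (a1⁻¹ * e b)) (λ i → index (W (e i))) b (UniqueP.allFin⁺ (suc m))
          (λ j∈ → binomial-root r (a1⁻¹ * e b) _ (solve-for-power (proj₂ (∈-fibre⁻ W j∈))))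

      -- x⁻¹ = x^(q²-2) for x ≠ 0
      inv : Carrier → Carrier
      inv x = pow F x (r ℕ.+ suc r ℕ.* q)

      inv-in-Fq : ∀ x → Fr x ≈ x → Fr (inv x) ≈ inv x
      inv-in-Fq x x∈Fq = trans (pow-swap x (r ℕ.+ suc r ℕ.* q) q) (pow-cong (r ℕ.+ suc r ℕ.* q) x∈Fq)

      trace-map : Fin (suc m) → Fin (suc m)
      trace-map j = index (e j + Fr (e j))

      pair-map : Fin (suc m) → Fin (suc m)
      pair-map j = index (e j + N * inv (e j))

      trace-fibre pair-fibre : Fin (suc m) → List (Fin (suc m))
      trace-fibre b = fibre trace-map b WValues
      pair-fibre  b = fibre pair-map b Fq*

      QuadraticRoot : Carrier → Carrier → Set ℓ
      QuadraticRoot t y = N + y * (- t + y) ≈ 0#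

      trace-fibre-roots : ∀ {b j} → j ∈ trace-fibre b → QuadraticRoot (e b) (e j)
      trace-fibre-roots {b} {j} j∈ with ∈-fibre⁻ (λ x → x + Fr x) {A = WValues} j∈
      ... | (j∈W , trace≈t) = begin
        N + w * (- t + w)                   ≈⟨ solve 4 (λ N w t Fw → N :+ w :* (:- t :+ w) := (N :- w :* Fw) :+ w :* ((w :+ Fw) :- t)) refl N w t (Fr w) ⟩
        (N - w * Fr w) + w * ((w + Fr w) - t) ≈⟨ +-cong (x≈y⇒x∙y⁻¹≈ε (sym (WValue-norm (∈-indicesWith⁻ IsWValue? j∈W))))
                                                       (trans (*-congˡ (x≈y⇒x∙y⁻¹≈ε trace≈t)) (zeroʳ w)) ⟩
        0# + 0#                             ≈⟨ +-identityʳ 0# ⟩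
        0#                                  ∎
        where
        w = e j
        t = e b

      pair-fibre-members : ∀ {b j} → j ∈ pair-fibre b → ((¬ e j ≈ 0#) × Fr (e j) ≈ e j) × (e j + N * inv (e j) ≈ e b)
      pair-fibre-members j∈ with ∈-fibre⁻ (λ x → x + N * inv x) {A = Fq*} j∈
      ... | (j∈Fq* , pair≈t) = ∈-indicesWith⁻ InFq*? j∈Fq* , pair≈t

      pair-fibre-roots : ∀ {b j} → j ∈ pair-fibre b → QuadraticRoot (e b) (e j)
      pair-fibre-roots {b} {j} j∈ with pair-fibre-members j∈
      ... | ((x≉0 , _) , pair≈t) = begin
        N + x * (- t + x)                     ≈⟨ +-congʳ (sym (*-identityʳ N)) ⟩
        N * 1# + x * (- t + x)                ≈⟨ solve 5 (λ N x t o i → N :* o :+ x :* (:- t :+ x)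
                                                   := N :* (o :- x :* i) :+ x :* ((x :+ N :* i) :- t)) refl N x t 1# (inv x) ⟩
        N * (1# - x * inv x) + x * ((x + N * inv x) - t)
                                              ≈⟨ +-cong (trans (*-congˡ (x≈y⇒x∙y⁻¹≈ε (sym (unit-power x x≉0)))) (zeroʳ N))
                                                        (trans (*-congˡ (x≈y⇒x∙y⁻¹≈ε pair≈t)) (zeroʳ x)) ⟩
        0# + 0#                               ≈⟨ +-identityʳ 0# ⟩
        0#                                    ∎
        where
        x = e j
        t = e b

      quadratic : Carrier → Vec Carrier 2
      quadratic t = trinomial 0 (- t) N

      quadratic-root : ∀ {t y} → QuadraticRoot t y → monic (quadratic t) y ≈ 0#
      quadratic-root {t} {y} root = trinomial-root 0 (- t) N y (trans (+-congˡ (*-congˡ (+-congˡ (*-identityʳ y)))) root)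

      -- if v lies in both fibres over t, then v is a double root of y² - t y + N,
      -- so both fibres are contained in {v}
      double-root : ∀ {b j} → j ∈ trace-fibre b → j ∈ pair-fibre b → ∀ {i} → QuadraticRoot (e b) (e i) → i ≡ j
      double-root {b} {j} j∈trace j∈pair {i} root = e-injective (x∙y⁻¹≈ε⇒x≈y y v (nilpotent⇒zero 2 (begin
        (y - v) * ((y - v) * 1#) ≈⟨ *-congˡ (*-identityʳ _) ⟩
        (y - v) * (y - v)        ≈⟨ solve 4 (λ y v t N → (y :- v) :* (y :- v)
                                      := (N :+ y :* (:- t :+ y)) :+ y :* (t :- (v :+ v)) :+ (v :* v :- N)) refl y v t N ⟩
        (N + y * (- t + y)) + y * (t - (v + v)) + (v * v - N)
                                 ≈⟨ zero-sum (zero-sum root (trans (*-congˡ (x≈y⇒x∙y⁻¹≈ε (sym v+v≈t))) (zeroʳ y)))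
                                             (x≈y⇒x∙y⁻¹≈ε v*v≈N) ⟩
        0#                       ∎)))
        where
        v = e j
        t = e b
        y = e i
        v∈Fq : Fr v ≈ v
        v∈Fq = proj₂ (proj₁ (pair-fibre-members j∈pair))
        v+v≈t : v + v ≈ t
        v+v≈t = trans (+-congˡ (sym v∈Fq)) (proj₂ (∈-fibre⁻ (λ x → x + Fr x) {A = WValues} j∈trace))
        v*v≈N : v * v ≈ N
        v*v≈N = trans (*-congˡ (sym v∈Fq))
                      (WValue-norm (∈-indicesWith⁻ IsWValue? (proj₁ (∈-fibre⁻ (λ x → x + Fr x) {A = WValues} j∈trace))))

      fibre-sizes : ∀ b → length (trace-fibre b) ℕ.+ length (pair-fibre b) ≤ 2
      fibre-sizes b with FinP.any? (λ j → (j ∈? trace-fibre b) ×-dec (j ∈? pair-fibre b))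
      ... | yes (j , j∈trace , j∈pair) =
        ℕP.+-mono-≤ (at-most-one _ (fibre-unique trace-map b WValues-unique) (λ i∈ → double-root j∈trace j∈pair (trace-fibre-roots i∈)))
                    (at-most-one _ (fibre-unique pair-map b Fq*-unique) (λ i∈ → double-root j∈trace j∈pair (pair-fibre-roots i∈)))
      ... | no  no-overlap = ℕP.≤-trans (ℕP.≤-reflexive (P.sym (LP.length-++ (trace-fibre b))))
        (root-bound (quadratic (e b)) (trace-fibre b ++ pair-fibre b)
          (UniqueP.++⁺ (fibre-unique trace-map b WValues-unique) (fibre-unique pair-map b Fq*-unique)
                       (λ (i∈trace , i∈pair) → no-overlap (_ , i∈trace , i∈pair)))
          (AllP.++⁺ (All.tabulate (quadratic-root ∘ trace-fibre-roots)) (All.tabulate (quadratic-root ∘ pair-fibre-roots))))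

      -- no W-value has trace -T, since it would give a root of f
      b₀ : Fin (suc m)
      b₀ = index (- T)

      b₀∈Fq : b₀ ∈ Fq
      b₀∈Fq = index-in-Fq (- T) (trans (Fr-neg T) (-‿cong T-in-Fq))

      trace-fibre-empty : length (trace-fibre b₀) ≡ 0
      trace-fibre-empty = empty (trace-fibre b₀) no-member
        where
        no-member : ∀ {j} → ¬ j ∈ trace-fibre b₀
        no-member {j} j∈ with ∈-fibre⁻ (λ x → x + Fr x) {A = WValues} j∈
        ... | (j∈W , trace≈-T) with ∈-indicesWith⁻ IsWValue? j∈W
        ... | (i , ei≉0 , W≈ej) = no-root (e i) ei≉0 (begin
          fTr F q a0 a1 (e i)                ≈⟨ f≈trace (e i) ⟩
          (W (e i) + Fr (W (e i))) + T       ≈⟨ +-congʳ (+-cong W≈ej (pow-cong q W≈ej)) ⟩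
          (e j + Fr (e j)) + T               ≈⟨ +-congʳ (trans trace≈-T (e-index (- T))) ⟩
          - T + T                            ≈⟨ -‿inverseˡ T ⟩
          0#                                 ∎)

      total-count : length WValues ℕ.+ length Fq* ≤ sumOver Fq (λ b → length (trace-fibre b) ℕ.+ length (pair-fibre b))
      total-count = ℕP.≤-trans (ℕP.+-mono-≤ (length≤sum-fibres trace-map WValues Fq trace-lands)
                                             (length≤sum-fibres pair-map Fq* Fq pair-lands))
                               (ℕP.≤-reflexive (P.sym (sumOver-+ Fq _ _)))
        where
        trace-lands : ∀ {j} → j ∈ WValues → trace-map j ∈ Fq
        trace-lands {j} _ = index-in-Fq _ (trace-in-Fq (e j))
        pair-lands : ∀ {j} → j ∈ Fq* → pair-map j ∈ Fq
        pair-lands {j} j∈ with ∈-indicesWith⁻ InFq*? j∈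
        ... | (_ , x∈Fq) = index-in-Fq _ (trans (Fr-+ x (N * inv x))
                                                (+-cong x∈Fq (trans (Fr-* N (inv x)) (*-cong N-in-Fq (inv-in-Fq x x∈Fq)))))
          where x = e j

      pair-fibre-large : ¬ length (pair-fibre b₀) ≤ 1
      pair-fibre-large ≤1 = pigeonhole r (length WValues) (length Fq*) (length Fq) Fq*-size WValues-size Fq-size
        (ℕP.≤-trans (s≤s total-count)
                    (sumOver-< Fq _ b₀ b₀∈Fq (P.subst (λ n → n ℕ.+ length (pair-fibre b₀) ≤ 1) (P.sym trace-fibre-empty) ≤1)
                               fibre-sizes))

      pair-fibre-root : ∀ {j} → j ∈ pair-fibre b₀ → g (e j) ≈ 0#
      pair-fibre-root {j} j∈ with pair-fibre-members j∈
      ... | ((x≉0 , _) , pair≈-T) = begin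
        x * x + T * x + N      ≈⟨ +-congˡ (sym (*-identityʳ N)) ⟩
        x * x + T * x + N * 1# ≈⟨ solve 5 (λ x T N o i → x :* x :+ T :* x :+ N :* o
                                      := x :* ((x :+ N :* i) :- (:- T)) :+ N :* (o :- x :* i)) refl x T N 1# (inv x) ⟩
        x * ((x + N * inv x) - (- T)) + N * (1# - x * inv x)
                               ≈⟨ +-cong (trans (*-congˡ (x≈y⇒x∙y⁻¹≈ε (trans pair≈-T (e-index (- T))))) (zeroʳ x))
                                         (trans (*-congˡ (x≈y⇒x∙y⁻¹≈ε (sym (unit-power x x≉0)))) (zeroʳ N)) ⟩
        0# + 0#                ≈⟨ +-identityʳ 0# ⟩
        0#                     ∎
        where x = e j

      two-roots : TwoRootsInFq
      two-roots = roots (two-elements (pair-fibre b₀) (fibre-unique pair-map b₀ Fq*-unique) pair-fibre-large)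
        where
        in-Fq : ∀ {i} → i ∈ pair-fibre b₀ → Fr (e i) ≈ e i
        in-Fq i∈ = proj₂ (proj₁ (pair-fibre-members i∈))
        roots : (∃[ i ] ∃[ j ] i ∈ pair-fibre b₀ × j ∈ pair-fibre b₀ × ¬ i ≡ j) → TwoRootsInFq
        roots (i , j , i∈ , j∈ , i≢j) =
          e i , e j , in-Fq i∈ , in-Fq j∈ , i≢j ∘ e-injective , pair-fibre-root i∈ , pair-fibre-root j∈

    forward : NoRoot → TwoRootsInFq
    forward no-root with a1 ≈? 0#
    ... | yes a1≈0 = degenerate-case a1≈0 no-root
    ... | no  a1≉0 = Counting.two-roots a1≉0 no-root

    backward : TwoRootsInFq → NoRoot
    backward (y , z , y∈Fq , z∈Fq , y≉z , gy≈0 , gz≈0) = Backward.no-root y z y∈Fq z∈Fq y≉z gy≈0 gz≈0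

prime-power-shape : ∀ {q p k} → Prime p → q ≡ p ℕ.^ suc k → ∃[ r ] ∃[ p′ ] q ≡ suc (suc r) × p ≡ suc p′
prime-power-shape {q} {p} {k} p-prime q≡p^[k+1] with PrimeBinomial.prime≥2 p-prime
... | s≤s (s≤s {n = p″} _) = at-least-two (P.subst (2 ≤_) (P.sym q≡p^[k+1]) 2≤p^[k+1])
  where
  2≤p^[k+1] : 2 ≤ p ℕ.^ suc k
  2≤p^[k+1] = ℕP.≤-trans (PrimeBinomial.prime≥2 p-prime) (ℕP.m≤m*n p (p ℕ.^ k) {{ℕP.m^n≢0 p k}})
  at-least-two : 2 ≤ q → ∃[ r ] ∃[ p′ ] q ≡ suc (suc r) × p ≡ suc p′
  at-least-two (s≤s (s≤s {n = r} _)) = r , suc p″ , P.refl , P.refl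

theorem3p2 : {c ℓ : Level} (q : ℕ) → IsPrimePower q →
    (F : CommutativeRing c ℓ) → IsField F → HasCard F (q ℕ.* q) →
    (a0 a1 : CommutativeRing.Carrier F) →
    let open CommutativeRing F in
    ((∀ x → ¬ x ≈ 0# → ¬ fTr F q a0 a1 x ≈ 0#)
      ⇔ (∃[ y ] ∃[ z ] InSubfield F q y × InSubfield F q z × ¬ y ≈ z
           × gPoly F q a0 a1 y ≈ 0# × gPoly F q a0 a1 z ≈ 0#))
theorem3p2 q (p , k , p-prime , q≡p^[k+1]) F isField card a0 a1
  with prime-power-shape {k = k} p-prime q≡p^[k+1]
... | r , p′ , P.refl , P.refl = mk⇔ forward backward
  where
  open Setting F isField r p′ k p-prime q≡p^[k+1] card using (module Coefficients)
  open Coefficients a0 a1 using (forward; backward)
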